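{- Let $S_n=\sum_{k=0}^n\binom{n}{k}^2\binom{2k}{k}(2k+1)$ for $n\geq 0$. Then $$\lim_{n\to\infty}\frac{\sqrt[n+1]{S_{n+1}}}{\sqrt[n]{S_n}}=1.$$ -}

module Defs where

open import Data.Nat using (ℕ; suc; _+_; _*_; _^_)
open import Data.Nat.Combinatorics using (_C_)
open import Data.List using (map; upTo)
open import Data.Nat.ListAction using (sum)

S : ℕ → ℕ
S n = sum (map (λ k → (n C k) ^ 2 * ((2 * k) C k) * (2 * k + 1)) (upTo (suc n)))

{-# OPTIONS --safe #-}
-- Write S n = Σₖ (n choose k)² wₖ with wₖ = (2k choose k)(2k+1). Pascal's rule together with
-- w_{k+1} ≤ 12 wₖ gives S n ≤ S (n+1) ≤ 39 S n, hence 1 ≤ S n ≤ 39ⁿ. So the ratio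
-- aₙ = S(n+1)^{1/(n+1)} / S(n)^{1/n} satisfies 39⁻ⁿ ≤ aₙ^{n(n+1)} = S(n+1)ⁿ / S(n)^{n+1} ≤ 39ⁿ,
-- i.e. 39^{-1/(n+1)} ≤ aₙ ≤ 39^{1/(n+1)}, and (1 ± ε)^{n+1} eventually leaves [1/39, 39]
-- by Bernoulli's inequality.
module Submission where

open import Defs
open import Data.Nat using (ℕ; zero; suc; _+_; _*_; _^_; _∸_; _<_; _≤_; s≤s; NonZero; >-nonZero)
open import Data.Nat.Properties
open import Data.Nat.Combinatorics using (_C_; nCk+nC[k+1]≡[n+1]C[k+1]; nCk≡nC[n∸k]; nC1≡n; k>n⇒nCk≡0)
open import Data.Nat.ListAction using (sum)
open import Data.Nat.ListAction.Properties using (sum-++)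
open import Data.Nat.Tactic.RingSolver using (solve; solve-∀)
open import Data.List using ([]; _∷_; _++_; upTo; applyUpTo)
open import Data.List.Properties using (applyUpTo-∷ʳ; map-cong; map-upTo)
open import Data.Product using (Σ; _×_; _,_)
open import Data.Sum using (inj₁; inj₂)
open import Relation.Binary.PropositionalEquality
import Algebra.Properties.CommutativeSemigroup as CommutativeSemigroupProperties
open CommutativeSemigroupProperties +-commutativeSemigroup using (interchange)
open CommutativeSemigroupProperties *-commutativeSemigroup
  using (x∙yz≈y∙xz; x∙yz≈y∙zx; x∙yz≈xz∙y) renaming (interchange to *-interchange)

sum-applyUpTo-suc : ∀ (f : ℕ → ℕ) m → sum (applyUpTo f (suc m)) ≡ sum (applyUpTo f m) + f m
sum-applyUpTo-suc f m = begin
  sum (applyUpTo f (suc m))        ≡⟨ cong sum (applyUpTo-∷ʳ f m) ⟨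
  sum (applyUpTo f m ++ f m ∷ [])  ≡⟨ sum-++ (applyUpTo f m) (f m ∷ []) ⟩
  sum (applyUpTo f m) + (f m + 0)  ≡⟨ cong (sum (applyUpTo f m) +_) (+-identityʳ (f m)) ⟩
  sum (applyUpTo f m) + f m        ∎
  where open ≡-Reasoning

sum-applyUpTo-mono : ∀ {f g : ℕ → ℕ} → (∀ k → f k ≤ g k) → ∀ m →
  sum (applyUpTo f m) ≤ sum (applyUpTo g m)
sum-applyUpTo-mono f≤g zero    = ≤-refl
sum-applyUpTo-mono f≤g (suc m) = +-mono-≤ (f≤g 0) (sum-applyUpTo-mono (λ k → f≤g (suc k)) m)

sum-applyUpTo-linear : ∀ a b {f g h : ℕ → ℕ} → (∀ k → f k ≤ a * g k + b * h k) → ∀ m →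
  sum (applyUpTo f m) ≤ a * sum (applyUpTo g m) + b * sum (applyUpTo h m)
sum-applyUpTo-linear a b f≤ zero    = ≤-reflexive (sym (cong₂ _+_ (*-zeroʳ a) (*-zeroʳ b)))
sum-applyUpTo-linear a b {f} {g} {h} f≤ (suc m) = begin
  f 0 + F                                   ≤⟨ +-mono-≤ (f≤ 0) (sum-applyUpTo-linear a b (λ k → f≤ (suc k)) m) ⟩
  (a * g 0 + b * h 0) + (a * G + b * H)     ≡⟨ interchange (a * g 0) (b * h 0) (a * G) (b * H) ⟩
  (a * g 0 + a * G) + (b * h 0 + b * H)     ≡⟨ cong₂ _+_ (*-distribˡ-+ a (g 0) G) (*-distribˡ-+ b (h 0) H) ⟨
  a * (g 0 + G) + b * (h 0 + H)             ∎
  where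
  open ≤-Reasoning
  F = sum (applyUpTo (λ k → f (suc k)) m)
  G = sum (applyUpTo (λ k → g (suc k)) m)
  H = sum (applyUpTo (λ k → h (suc k)) m)

nCk≤[n+1]Ck : ∀ n k → n C k ≤ suc n C k
nCk≤[n+1]Ck n zero    = ≤-refl
nCk≤[n+1]Ck n (suc k) = ≤-trans (m≤n+m (n C suc k) (n C k)) (≤-reflexive (nCk+nC[k+1]≡[n+1]C[k+1] n k))

[k+1]*[n+1]C[k+1]≡[n+1]*nCk : ∀ n k → suc k * (suc n C suc k) ≡ suc n * (n C k)
[k+1]*[n+1]C[k+1]≡[n+1]*nCk zero    zero    = refl
[k+1]*[n+1]C[k+1]≡[n+1]*nCk zero    (suc k) = *-zeroʳ (suc (suc k))
[k+1]*[n+1]C[k+1]≡[n+1]*nCk (suc n) zero    =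
  trans (+-identityʳ _) (trans (nC1≡n (suc (suc n))) (sym (*-identityʳ (suc (suc n)))))
[k+1]*[n+1]C[k+1]≡[n+1]*nCk (suc n) (suc k) = begin
  suc (suc k) * (suc (suc n) C suc (suc k))   ≡⟨ cong (suc (suc k) *_) (nCk+nC[k+1]≡[n+1]C[k+1] (suc n) (suc k)) ⟨
  suc (suc k) * (a + b)                       ≡⟨ *-distribˡ-+ (suc (suc k)) a b ⟩
  (a + suc k * a) + suc (suc k) * b           ≡⟨ +-assoc a (suc k * a) (suc (suc k) * b) ⟩
  a + (suc k * a + suc (suc k) * b)           ≡⟨ cong₂ (λ u v → a + (u + v)) ([k+1]*[n+1]C[k+1]≡[n+1]*nCk n k)
                                                                           ([k+1]*[n+1]C[k+1]≡[n+1]*nCk n (suc k)) ⟩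
  a + (suc n * (n C k) + suc n * (n C suc k)) ≡⟨ cong (a +_) (*-distribˡ-+ (suc n) (n C k) (n C suc k)) ⟨
  a + suc n * (n C k + n C suc k)             ≡⟨ cong (λ u → a + suc n * u) (nCk+nC[k+1]≡[n+1]C[k+1] n k) ⟩
  a + suc n * a                               ∎
  where
  open ≡-Reasoning
  a = suc n C suc k
  b = suc n C suc (suc k)

[2j+1]Cj≡[2j+1]C[j+1] : ∀ j → suc (2 * j) C j ≡ suc (2 * j) C suc j
[2j+1]Cj≡[2j+1]C[j+1] j = begin
  suc (2 * j) C j                   ≡⟨ nCk≡nC[n∸k] (m≤n⇒m≤1+n (m≤m+n j (j + 0))) ⟩
  suc (2 * j) C (suc (2 * j) ∸ j)   ≡⟨ cong (λ m → suc (2 * j) C (m ∸ j)) 1+2j≡j+[1+j] ⟩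
  suc (2 * j) C (j + suc j ∸ j)     ≡⟨ cong (suc (2 * j) C_) (m+n∸m≡n j (suc j)) ⟩
  suc (2 * j) C suc j               ∎
  where
  open ≡-Reasoning
  1+2j≡j+[1+j] : suc (2 * j) ≡ j + suc j
  1+2j≡j+[1+j] = solve (j ∷ [])

[2j+1]C[j+1]≤2*[2j]Cj : ∀ j → suc (2 * j) C suc j ≤ 2 * (2 * j C j)
[2j+1]C[j+1]≤2*[2j]Cj j = *-cancelˡ-≤ (suc j) (begin
  suc j * (suc (2 * j) C suc j)    ≡⟨ [k+1]*[n+1]C[k+1]≡[n+1]*nCk (2 * j) j ⟩
  suc (2 * j) * (2 * j C j)        ≤⟨ *-monoˡ-≤ (2 * j C j) (n≤1+n (suc (2 * j))) ⟩
  suc (suc (2 * j)) * (2 * j C j)  ≡⟨ cong (_* (2 * j C j)) 2+2j≡[1+j]*2 ⟩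
  suc j * 2 * (2 * j C j)          ≡⟨ *-assoc (suc j) 2 (2 * j C j) ⟩
  suc j * (2 * (2 * j C j))        ∎)
  where
  open ≤-Reasoning
  2+2j≡[1+j]*2 : suc (suc (2 * j)) ≡ suc j * 2
  2+2j≡[1+j]*2 = solve (j ∷ [])

[2j+2]C[j+1]≤4*[2j]Cj : ∀ j → 2 * suc j C suc j ≤ 4 * (2 * j C j)
[2j+2]C[j+1]≤4*[2j]Cj j = begin
  2 * suc j C suc j                              ≡⟨ cong (_C suc j) 2[1+j]≡2+2j ⟩
  suc (suc (2 * j)) C suc j                      ≡⟨ nCk+nC[k+1]≡[n+1]C[k+1] (suc (2 * j)) j ⟨
  suc (2 * j) C j + suc (2 * j) C suc j          ≡⟨ cong (_+ suc (2 * j) C suc j) ([2j+1]Cj≡[2j+1]C[j+1] j) ⟩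
  suc (2 * j) C suc j + suc (2 * j) C suc j      ≤⟨ +-mono-≤ ([2j+1]C[j+1]≤2*[2j]Cj j) ([2j+1]C[j+1]≤2*[2j]Cj j) ⟩
  2 * (2 * j C j) + 2 * (2 * j C j)              ≡⟨ *-distribʳ-+ (2 * j C j) 2 2 ⟨
  4 * (2 * j C j)                                ∎
  where
  open ≤-Reasoning
  2[1+j]≡2+2j : 2 * suc j ≡ suc (suc (2 * j))
  2[1+j]≡2+2j = solve (j ∷ [])

m*n≤m*m+n*n : ∀ m n → m * n ≤ m * m + n * n
m*n≤m*m+n*n m n with ≤-total m n
... | inj₁ m≤n = ≤-trans (*-monoˡ-≤ n m≤n) (m≤n+m (n * n) (m * m))
... | inj₂ n≤m = ≤-trans (*-monoʳ-≤ m n≤m) (m≤m+n (m * m) (n * n))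

m^2≡m*m : ∀ m → m ^ 2 ≡ m * m
m^2≡m*m m = cong (m *_) (*-identityʳ m)

[m+n]^2≤3*[m^2+n^2] : ∀ m n → (m + n) ^ 2 ≤ 3 * (m ^ 2 + n ^ 2)
[m+n]^2≤3*[m^2+n^2] m n = begin
  (m + n) ^ 2                            ≡⟨ m^2≡m*m (m + n) ⟩
  (m + n) * (m + n)                      ≡⟨ solve (m ∷ n ∷ []) ⟩
  (m * m + n * n) + 2 * (m * n)          ≤⟨ +-monoʳ-≤ (m * m + n * n) (*-monoʳ-≤ 2 (m*n≤m*m+n*n m n)) ⟩
  3 * (m * m + n * n)                    ≡⟨ cong (3 *_) (cong₂ _+_ (m^2≡m*m m) (m^2≡m*m n)) ⟨
  3 * (m ^ 2 + n ^ 2)                    ∎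
  where open ≤-Reasoning

[a+b]^2*u≤3c*[a^2*v]+3*[b^2*u] : ∀ a b c u v → u ≤ c * v →
  (a + b) ^ 2 * u ≤ 3 * c * (a ^ 2 * v) + 3 * (b ^ 2 * u)
[a+b]^2*u≤3c*[a^2*v]+3*[b^2*u] a b c u v u≤cv = begin
  (a + b) ^ 2 * u                          ≤⟨ *-monoˡ-≤ u ([m+n]^2≤3*[m^2+n^2] a b) ⟩
  3 * (a ^ 2 + b ^ 2) * u                  ≡⟨ distribute (a ^ 2) (b ^ 2) u ⟩
  3 * (a ^ 2 * u) + 3 * (b ^ 2 * u)        ≤⟨ +-monoˡ-≤ (3 * (b ^ 2 * u)) (*-monoʳ-≤ 3 (*-monoʳ-≤ (a ^ 2) u≤cv)) ⟩
  3 * (a ^ 2 * (c * v)) + 3 * (b ^ 2 * u)  ≡⟨ cong (_+ 3 * (b ^ 2 * u)) (regroup (a ^ 2) c v) ⟩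
  3 * c * (a ^ 2 * v) + 3 * (b ^ 2 * u)    ∎
  where
  open ≤-Reasoning
  distribute : ∀ x y z → 3 * (x + y) * z ≡ 3 * (x * z) + 3 * (y * z)
  distribute = solve-∀
  regroup : ∀ x y z → 3 * (x * (y * z)) ≡ 3 * y * (x * z)
  regroup = solve-∀

binomialSquare : (ℕ → ℕ) → ℕ → ℕ → ℕ
binomialSquare w n k = (n C k) ^ 2 * w k

binomialSquareSum : (ℕ → ℕ) → ℕ → ℕ
binomialSquareSum w n = sum (applyUpTo (binomialSquare w n) (suc n))

binomialSquare-suc : ∀ w c → (∀ k → w (suc k) ≤ c * w k) → ∀ n j →
  binomialSquare w (suc n) (suc j) ≤ 3 * c * binomialSquare w n j + 3 * binomialSquare w n (suc j)
binomialSquare-suc w c growth n j =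
  subst (λ b → b ^ 2 * w (suc j) ≤ 3 * c * binomialSquare w n j + 3 * binomialSquare w n (suc j))
        (nCk+nC[k+1]≡[n+1]C[k+1] n j)
        ([a+b]^2*u≤3c*[a^2*v]+3*[b^2*u] (n C j) (n C suc j) c (w (suc j)) (w j) (growth j))

binomialSquareSum-extend : ∀ w n →
  binomialSquareSum w n ≡ sum (applyUpTo (binomialSquare w n) (suc (suc n)))
binomialSquareSum-extend w n = sym (begin
  sum (applyUpTo (binomialSquare w n) (suc (suc n)))  ≡⟨ sum-applyUpTo-suc (binomialSquare w n) (suc n) ⟩
  binomialSquareSum w n + binomialSquare w n (suc n)  ≡⟨ cong (λ b → binomialSquareSum w n + b ^ 2 * w (suc n))
                                                            (k>n⇒nCk≡0 (n<1+n n)) ⟩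
  binomialSquareSum w n + 0                           ≡⟨ +-identityʳ (binomialSquareSum w n) ⟩
  binomialSquareSum w n                               ∎)
  where open ≡-Reasoning

binomialSquareSum-positive : ∀ w → 1 ≤ w 0 → ∀ n → 1 ≤ binomialSquareSum w n
binomialSquareSum-positive w 1≤w0 n =
  ≤-trans 1≤w0 (≤-trans (m≤m+n (w 0) 0) (m≤m+n (w 0 + 0) _))

binomialSquareSum-mono : ∀ w n → binomialSquareSum w n ≤ binomialSquareSum w (suc n)
binomialSquareSum-mono w n = begin
  binomialSquareSum w n                               ≡⟨ binomialSquareSum-extend w n ⟩
  sum (applyUpTo (binomialSquare w n) (suc (suc n)))  ≤⟨ sum-applyUpTo-mono square-mono (suc (suc n)) ⟩
  binomialSquareSum w (suc n)                         ∎
  where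
  open ≤-Reasoning
  square-mono : ∀ k → binomialSquare w n k ≤ binomialSquare w (suc n) k
  square-mono k = *-monoˡ-≤ (w k) (^-monoˡ-≤ 2 (nCk≤[n+1]Ck n k))

binomialSquareSum-step : ∀ w c → (∀ k → w (suc k) ≤ c * w k) → ∀ n →
  binomialSquareSum w (suc n) ≤ (3 * c + 3) * binomialSquareSum w n
binomialSquareSum-step w c growth n = begin
  binomialSquareSum w (suc n)   ≤⟨ +-monoʳ-≤ h shifted-terms ⟩
  h + (3 * c * T + 3 * R)       ≤⟨ absorb-head h (3 * c * T) R ⟩
  3 * c * T + 3 * (h + R)       ≡⟨ cong (λ t → 3 * c * T + 3 * t) (binomialSquareSum-extend w n) ⟨
  3 * c * T + 3 * T             ≡⟨ *-distribʳ-+ T (3 * c) 3 ⟨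
  (3 * c + 3) * T               ∎
  where
  open ≤-Reasoning
  -- the k = 0 terms of the sums for n and for n + 1 both compute to 1 * w 0
  h = binomialSquare w n 0
  T = binomialSquareSum w n
  R = sum (applyUpTo (λ j → binomialSquare w n (suc j)) (suc n))
  shifted-terms : sum (applyUpTo (λ j → binomialSquare w (suc n) (suc j)) (suc n)) ≤ 3 * c * T + 3 * R
  shifted-terms = sum-applyUpTo-linear (3 * c) 3 {g = binomialSquare w n} {h = λ j → binomialSquare w n (suc j)}
                    (binomialSquare-suc w c growth n) (suc n)
  absorb-head : ∀ x y z → x + (y + 3 * z) ≤ y + 3 * (x + z)
  absorb-head x y z = begin
    x + (y + 3 * z)          ≤⟨ m≤m+n (x + (y + 3 * z)) (2 * x) ⟩
    x + (y + 3 * z) + 2 * x  ≡⟨ solve (x ∷ y ∷ z ∷ []) ⟩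
    y + 3 * (x + z)          ∎

centralWeight : ℕ → ℕ
centralWeight k = (2 * k C k) * (2 * k + 1)

centralWeight-suc : ∀ k → centralWeight (suc k) ≤ 12 * centralWeight k
centralWeight-suc k = begin
  (2 * suc k C suc k) * (2 * suc k + 1)        ≤⟨ *-mono-≤ ([2j+2]C[j+1]≤4*[2j]Cj k) odd-step ⟩
  (4 * (2 * k C k)) * (3 * (2 * k + 1))        ≡⟨ regroup (2 * k C k) (2 * k + 1) ⟩
  12 * ((2 * k C k) * (2 * k + 1))             ∎
  where
  open ≤-Reasoning
  odd-step : 2 * suc k + 1 ≤ 3 * (2 * k + 1)
  odd-step = ≤-trans (m≤m+n (2 * suc k + 1) (4 * k)) (≤-reflexive (solve (k ∷ [])))
  regroup : ∀ x y → (4 * x) * (3 * y) ≡ 12 * (x * y)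
  regroup = solve-∀

S≡binomialSquareSum : ∀ n → S n ≡ binomialSquareSum centralWeight n
S≡binomialSquareSum n = trans
  (cong sum (map-cong (λ k → *-assoc ((n C k) ^ 2) (2 * k C k) (2 * k + 1)) (upTo (suc n))))
  (cong sum (map-upTo (binomialSquare centralWeight n) (suc n)))

S-positive : ∀ n → 1 ≤ S n
S-positive n = subst (1 ≤_) (sym (S≡binomialSquareSum n))
  (binomialSquareSum-positive centralWeight ≤-refl n)

S-mono : ∀ n → S n ≤ S (suc n)
S-mono n = subst₂ _≤_ (sym (S≡binomialSquareSum n)) (sym (S≡binomialSquareSum (suc n)))
  (binomialSquareSum-mono centralWeight n)

S-step : ∀ n → S (suc n) ≤ 39 * S n
S-step n = subst₂ (λ a b → a ≤ 39 * b)
  (sym (S≡binomialSquareSum (suc n))) (sym (S≡binomialSquareSum n))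
  (binomialSquareSum-step centralWeight 12 centralWeight-suc n)

S≤39^n : ∀ n → S n ≤ 39 ^ n
S≤39^n zero    = ≤-refl
S≤39^n (suc n) = ≤-trans (S-step n) (*-monoʳ-≤ 39 (S≤39^n n))

-- Bernoulli's inequality (1 + 1/m)^k ≥ 1 + k/m, cleared of denominators.
m^k*[m+k]≤m*[1+m]^k : ∀ m k → m ^ k * (m + k) ≤ m * suc m ^ k
m^k*[m+k]≤m*[1+m]^k m zero    =
  ≤-reflexive (trans (+-identityʳ (m + 0)) (trans (+-identityʳ m) (sym (*-identityʳ m))))
m^k*[m+k]≤m*[1+m]^k m (suc k) = begin
  m * m ^ k * (m + suc k)              ≤⟨ m≤m+n (m * m ^ k * (m + suc k)) (m ^ k * k) ⟩
  m * m ^ k * (m + suc k) + m ^ k * k  ≡⟨ expand m (m ^ k) k ⟨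
  suc m * (m ^ k * (m + k))            ≤⟨ *-monoʳ-≤ (suc m) (m^k*[m+k]≤m*[1+m]^k m k) ⟩
  suc m * (m * suc m ^ k)              ≡⟨ x∙yz≈y∙xz (suc m) m (suc m ^ k) ⟩
  m * (suc m * suc m ^ k)              ∎
  where
  open ≤-Reasoning
  expand : ∀ x a k → suc x * (a * (x + k)) ≡ x * a * (x + suc k) + a * k
  expand = solve-∀

m<n⇒m^k*o<n^k : ∀ {m n} o → m < n → ∀ {k} → o * m < k → m ^ k * o < n ^ k
m<n⇒m^k*o<n^k {zero}  {suc n} o _   {suc k} _    = m^n>0 (suc n) (suc k)
m<n⇒m^k*o<n^k {suc m} {n}     o m<n {k}     om<k =
  *-cancelˡ-< (suc m) (suc m ^ k * o) (n ^ k) (begin-strict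
  suc m * (suc m ^ k * o)  ≡⟨ x∙yz≈y∙zx (suc m) (suc m ^ k) o ⟩
  suc m ^ k * (o * suc m)  <⟨ *-monoʳ-< (suc m ^ k) {{m^n≢0 (suc m) k}} (≤-trans om<k (m≤n+m k (suc m))) ⟩
  suc m ^ k * (suc m + k)  ≤⟨ m^k*[m+k]≤m*[1+m]^k (suc m) k ⟩
  suc m * suc (suc m) ^ k  ≤⟨ *-monoʳ-≤ (suc m) (^-monoˡ-≤ k m<n) ⟩
  suc m * n ^ k            ∎)
  where open ≤-Reasoning

[m*n]^k≡m^k*n^k : ∀ m n k → (m * n) ^ k ≡ m ^ k * n ^ k
[m*n]^k≡m^k*n^k m n zero    = refl
[m*n]^k≡m^k*n^k m n (suc k) =
  trans (cong (m * n *_) ([m*n]^k≡m^k*n^k m n k)) (*-interchange m n (m ^ k) (n ^ k))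

m^[n*[1+n]]≡[m^[1+n]]^n : ∀ m n → m ^ (n * suc n) ≡ (m ^ suc n) ^ n
m^[n*[1+n]]≡[m^[1+n]]^n m n = trans (cong (m ^_) (*-comm n (suc n))) (sym (^-*-assoc m (suc n) n))

-- RootRatioAbove s x y n : x / y < s(n+1)^(1/(n+1)) / s(n)^(1/n), and RootRatioBelow the reverse
-- strict inequality, both raised to the power n(n+1) so as to stay in ℕ.
RootRatioAbove RootRatioBelow : (ℕ → ℕ) → ℕ → ℕ → ℕ → Set
RootRatioAbove s x y n = x ^ (n * suc n) * s n ^ suc n < y ^ (n * suc n) * s (suc n) ^ n
RootRatioBelow s x y n = y ^ (n * suc n) * s (suc n) ^ n < x ^ (n * suc n) * s n ^ suc n

rootRatioAbove : ∀ (s : ℕ → ℕ) x y B n .{{_ : NonZero n}} →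
  1 ≤ s n → s n ≤ B ^ n → s n ≤ s (suc n) → x ^ suc n * B < y ^ suc n → RootRatioAbove s x y n
rootRatioAbove s x y B n 1≤sₙ sₙ≤Bⁿ sₙ≤sₙ₊₁ xB<y = begin-strict
  x ^ (n * suc n) * s n ^ suc n  ≡⟨ cong₂ _*_ (m^[n*[1+n]]≡[m^[1+n]]^n x n) (*-comm (s n) (s n ^ n)) ⟩
  X ^ n * (s n ^ n * s n)        ≤⟨ *-monoʳ-≤ (X ^ n) (*-monoʳ-≤ (s n ^ n) sₙ≤Bⁿ) ⟩
  X ^ n * (s n ^ n * B ^ n)      ≡⟨ x∙yz≈xz∙y (X ^ n) (s n ^ n) (B ^ n) ⟩
  X ^ n * B ^ n * s n ^ n        ≡⟨ cong (_* s n ^ n) ([m*n]^k≡m^k*n^k X B n) ⟨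
  (X * B) ^ n * s n ^ n          <⟨ *-monoˡ-< (s n ^ n) {{m^n≢0 (s n) n {{>-nonZero 1≤sₙ}}}} (^-monoˡ-< n xB<y) ⟩
  Y ^ n * s n ^ n                ≤⟨ *-monoʳ-≤ (Y ^ n) (^-monoˡ-≤ n sₙ≤sₙ₊₁) ⟩
  Y ^ n * s (suc n) ^ n          ≡⟨ cong (_* s (suc n) ^ n) (m^[n*[1+n]]≡[m^[1+n]]^n y n) ⟨
  y ^ (n * suc n) * s (suc n) ^ n ∎
  where
  open ≤-Reasoning
  X = x ^ suc n
  Y = y ^ suc n

rootRatioBelow : ∀ (s : ℕ → ℕ) x y B n .{{_ : NonZero n}} →
  1 ≤ s n → s (suc n) ≤ B * s n → y ^ suc n * B < x ^ suc n → RootRatioBelow s x y n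
rootRatioBelow s x y B n 1≤sₙ sₙ₊₁≤Bsₙ yB<x = begin-strict
  y ^ (n * suc n) * s (suc n) ^ n  ≡⟨ cong (_* s (suc n) ^ n) (m^[n*[1+n]]≡[m^[1+n]]^n y n) ⟩
  Y ^ n * s (suc n) ^ n            ≤⟨ *-monoʳ-≤ (Y ^ n) (^-monoˡ-≤ n sₙ₊₁≤Bsₙ) ⟩
  Y ^ n * (B * s n) ^ n            ≡⟨ cong (Y ^ n *_) ([m*n]^k≡m^k*n^k B (s n) n) ⟩
  Y ^ n * (B ^ n * s n ^ n)        ≡⟨ *-assoc (Y ^ n) (B ^ n) (s n ^ n) ⟨
  Y ^ n * B ^ n * s n ^ n          ≡⟨ cong (_* s n ^ n) ([m*n]^k≡m^k*n^k Y B n) ⟨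
  (Y * B) ^ n * s n ^ n            <⟨ *-monoˡ-< (s n ^ n) {{m^n≢0 (s n) n {{>-nonZero 1≤sₙ}}}} (^-monoˡ-< n yB<x) ⟩
  X ^ n * s n ^ n                  ≤⟨ *-monoʳ-≤ (X ^ n) (m≤n*m (s n ^ n) (s n) {{>-nonZero 1≤sₙ}}) ⟩
  X ^ n * s n ^ suc n              ≡⟨ cong (_* s n ^ suc n) (m^[n*[1+n]]≡[m^[1+n]]^n x n) ⟨
  x ^ (n * suc n) * s n ^ suc n    ∎
  where
  open ≤-Reasoning
  X = x ^ suc n
  Y = y ^ suc n

theorem4p11 : (p q : ℕ) → 0 < p → 0 < q →
    Σ ℕ (λ N → (n : ℕ) → N ≤ n → 1 ≤ n →
      ((q ∸ p) ^ (n * suc n) * S n ^ suc n < q ^ (n * suc n) * S (suc n) ^ n)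
      × (q ^ (n * suc n) * S (suc n) ^ n < (q + p) ^ (n * suc n) * S n ^ suc n))
theorem4p11 p q 0<p 0<q = 39 * q , λ n 39q≤n 1≤n →
    rootRatioAbove S (q ∸ p) q 39 n {{>-nonZero 1≤n}} (S-positive n) (S≤39^n n) (S-mono n)
      (m<n⇒m^k*o<n^k 39 q∸p<q (s≤s (≤-trans (*-monoʳ-≤ 39 (m∸n≤m q p)) 39q≤n)))
  , rootRatioBelow S (q + p) q 39 n {{>-nonZero 1≤n}} (S-positive n) (S-step n)
      (m<n⇒m^k*o<n^k 39 (m<m+n q 0<p) (s≤s 39q≤n))
  where
  q∸p<q : q ∸ p < q
  q∸p<q = m<n+o⇒m∸n<o q p {{>-nonZero 0<q}} (m<n+m q 0<p)
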